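{- For all positive integers $n,k$ with $n\ge 2k+1$, one has $\dfrac{d_{n,k}}{d_{n-1,k}}\ge X(n,k)$, where $$X(n,k)=\frac12\Big(3+\frac{k-1}{2n-3k+3}+\frac{k+3}{n-2k}-\frac{k+2}{2n-3k}\Big)+\frac{\sqrt{y(n,k)}}{2(2n-3k+3)(2n-3k)(n-2k)}$$ and $$y(n,k)=\big(4n^2+(4-12k)n+9k^2-5k\big)\big(4n^4+(28-36k)n^3+(60-149k+117k^2)n^2+(36-174k+276k^2-162k^3)n+81k^4-171k^3+135k^2-45k\big).$$
   Context: For integers $n\ge0$, $k\ge0$, $d_{n,k}:=\sum_{i=2k}^{n}(n-i+1)\binom{n-k+1}{i-2k}$ (an empty sum being $0$). -}

module Defs where

open import Data.Nat as ℕ using (ℕ; zero; suc; _∸_)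
open import Data.Nat.Combinatorics using (_C_)
open import Data.List using (List; map; upTo)
open import Data.Nat.ListAction using (sum)
open import Data.Integer as ℤ using (ℤ; +_)
open import Data.Rational as ℚ using (ℚ; 0ℚ; _÷_; ≢-nonZero; _+_; _*_; _-_)
open import Data.Rational.Properties using (_≟_)
open import Relation.Nullary using (yes; no)

-- d_{n,k} = Σ_{i=2k}^{n} (n-i+1) * C(n-k+1, i-2k), empty sum = 0.
-- The index i runs as i = 2k + j for j = 0 .. (n+1 ∸ 2k) - 1, i.e. 2k ≤ i ≤ n.
d : ℕ → ℕ → ℕ
d n k = sum (map term (upTo (suc n ∸ 2 ℕ.* k)))
  where
  term : ℕ → ℕ
  term j = let i = 2 ℕ.* k ℕ.+ j in (n ∸ i ℕ.+ 1) ℕ.* ((n ∸ k ℕ.+ 1) C (i ∸ 2 ℕ.* k))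

ℤ→ℚ : ℤ → ℚ
ℤ→ℚ z = z ℚ./ 1

ℕ→ℚ : ℕ → ℚ
ℕ→ℚ m = ℤ→ℚ (+ m)

-- total division on ℚ (value 0 when dividing by 0; only used with nonzero denominators)
_÷'_ : ℚ → ℚ → ℚ
p ÷' q with q ≟ 0ℚ
... | yes _ = 0ℚ
... | no q≢0 = _÷_ p q {{≢-nonZero q≢0}}

infixl 7 _÷'_

y : ℕ → ℕ → ℚ
y n k = let m = ℕ→ℚ n ; c = ℕ→ℚ k ; q = ℕ→ℚ in
  ((q 4 * m * m) + ((q 4 - q 12 * c) * m) + (q 9 * c * c) - (q 5 * c))
  * ((q 4 * m * m * m * m)
     + ((q 28 - q 36 * c) * m * m * m)
     + ((q 60 - q 149 * c + q 117 * c * c) * m * m)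
     + ((q 36 - q 174 * c + q 276 * c * c - q 162 * c * c * c) * m)
     + (q 81 * c * c * c * c) - (q 171 * c * c * c) + (q 135 * c * c) - (q 45 * c))

-- rational part of X(n,k):  ½(3 + (k-1)/(2n-3k+3) + (k+3)/(n-2k) - (k+2)/(2n-3k))
Xrat : ℕ → ℕ → ℚ
Xrat n k = let m = ℕ→ℚ n ; c = ℕ→ℚ k ; q = ℕ→ℚ in
  (q 1 ÷' q 2) * (q 3 + ((c - q 1) ÷' (q 2 * m - q 3 * c + q 3))
                      + ((c + q 3) ÷' (m - q 2 * c))
                      - ((c + q 2) ÷' (q 2 * m - q 3 * c)))

-- denominator of the square-root part of X(n,k):  2(2n-3k+3)(2n-3k)(n-2k)
Xden : ℕ → ℕ → ℚ
Xden n k = let m = ℕ→ℚ n ; c = ℕ→ℚ k ; q = ℕ→ℚ in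
  q 2 * (q 2 * m - q 3 * c + q 3) * (q 2 * m - q 3 * c) * (m - q 2 * c)

-- "√a ≤ b" for rationals a, b (a ≥ 0 so that √a is defined):
--   0 ≤ a, 0 ≤ b and a ≤ b².
SqrtLe : ℚ → ℚ → Set
SqrtLe a b = (0ℚ ℚ.≤ a) × (0ℚ ℚ.≤ b) × (a ℚ.≤ b ℚ.* b)
  where open import Data.Product using (_×_)

module Submission where

-- Write p = n − 2k ≥ 1. With α = (2n−3k+3)(2n−3k)(n−2k) and β = −2α·(rational part of X),
-- both polynomials in k and p, and γ defined by y = β² − 4αγ, X(n,k) = (−β + √y)/(2α) is the
-- larger root of αt² + βt + γ. So the claim says that Ψ_p(x, w) = αx² + βxw + γw² is
-- nonnegative at (x, w) = (d_{n,k}, d_{n−1,k}), on the side of the vertex where 2αx + βw ≥ 0.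
-- Via partial row sums of binomial coefficients, d_{2k+p,k} satisfies the recurrence
-- (p+1)·d_{2k+p+1,k} = (k+3p+4)·d_{2k+p,k} − 2(k+p+1)·d_{2k+p−1,k}, along which the invariant
-- Ψ_p(x, w) ≥ 0, x ≥ 2w > 0 propagates by induction on p: as Ψ_p(2, 1) < 0, x/w lies right of
-- the larger root, hence right of a point v/u with Ψ_p(v, u) ≤ 0, and the identity
-- α·Ψ_{p+1}(Px − Qw, Sx) = F·(X₂·Ψ_p(x, w) + w·(ux − vw)) with F, X₂, u ≥ 0 gives Ψ_{p+1} ≥ 0.

open import Defs

module BinomialSums where

  open import Data.Nat
  open import Data.Nat.Properties
  open import Data.Nat.Combinatorics using (_C_; nC1≡n; nCk+nC[k+1]≡[n+1]C[k+1])
  open import Data.Nat.ListAction using (sum)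
  open import Data.Nat.ListAction.Properties using (sum-++)
  open import Data.Nat.Tactic.RingSolver using (solve-∀)
  open import Algebra.Properties.CommutativeSemigroup +-commutativeSemigroup using (interchange)
  open import Data.List using (map; upTo; _++_; [_]; _∷ʳ_)
  open import Data.List.Properties using (map-++; applyUpTo-∷ʳ)
  open import Function using (id; _∘′_)
  open import Relation.Binary.PropositionalEquality
    using (_≡_; refl; sym; trans; cong; cong₂; module ≡-Reasoning)
  open ≡-Reasoning

  ∑< : (ℕ → ℕ) → ℕ → ℕ
  ∑< f zero    = 0
  ∑< f (suc N) = ∑< f N + f N

  infix 5 ∑<
  syntax ∑< (λ j → e) N = ∑[ j < N ] e

  ∑<-cong : ∀ {f g} N → (∀ j → j < N → f j ≡ g j) → ∑< f N ≡ ∑< g N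
  ∑<-cong zero    f≗g = refl
  ∑<-cong (suc N) f≗g =
    cong₂ _+_ (∑<-cong N (λ j j<N → f≗g j (m<n⇒m<1+n j<N))) (f≗g N (n<1+n N))

  ∑<-distrib-+ : ∀ f g N → (∑[ j < N ] f j + g j) ≡ ∑< f N + ∑< g N
  ∑<-distrib-+ f g zero    = refl
  ∑<-distrib-+ f g (suc N) = begin
    (∑[ j < N ] f j + g j) + (f N + g N) ≡⟨ cong (_+ (f N + g N)) (∑<-distrib-+ f g N) ⟩
    ∑< f N + ∑< g N + (f N + g N)        ≡⟨ interchange (∑< f N) (∑< g N) (f N) (g N) ⟩
    ∑< f N + f N + (∑< g N + g N)        ∎

  sum-map-upTo : ∀ f N → sum (map f (upTo N)) ≡ ∑< f N
  sum-map-upTo f zero    = refl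
  sum-map-upTo f (suc N) = begin
    sum (map f (upTo (suc N)))       ≡⟨ cong (sum ∘′ map f) (applyUpTo-∷ʳ id N) ⟨
    sum (map f (upTo N ∷ʳ N))        ≡⟨ cong sum (map-++ f (upTo N) [ N ]) ⟩
    sum (map f (upTo N) ++ [ f N ])  ≡⟨ sum-++ (map f (upTo N)) [ f N ] ⟩
    sum (map f (upTo N)) + (f N + 0) ≡⟨ cong₂ _+_ (sum-map-upTo f N) (+-identityʳ (f N)) ⟩
    ∑< f N + f N                     ∎

  partialRowSum : ℕ → ℕ → ℕ
  partialRowSum M N = ∑[ j < N ] M C j

  weightedRowSum : ℕ → ℕ → ℕ
  weightedRowSum M r = ∑[ j < suc r ] (r ∸ j + 1) * (M C j)

  private
    pascal : ∀ n k → suc n C suc k ≡ n C k + n C suc k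
    pascal n k = sym (nCk+nC[k+1]≡[n+1]C[k+1] n k)

  [1+k]*[1+n]C[1+k]≡[1+n]*nCk : ∀ n k → suc k * (suc n C suc k) ≡ suc n * (n C k)
  [1+k]*[1+n]C[1+k]≡[1+n]*nCk zero    zero    = refl
  [1+k]*[1+n]C[1+k]≡[1+n]*nCk zero    (suc k) = *-zeroʳ (2 + k)
  [1+k]*[1+n]C[1+k]≡[1+n]*nCk (suc n) zero    = begin
    1 * (suc (suc n) C 1) ≡⟨ *-identityˡ _ ⟩
    suc (suc n) C 1       ≡⟨ nC1≡n (suc (suc n)) ⟩
    suc (suc n)           ≡⟨ *-identityʳ (suc (suc n)) ⟨
    suc (suc n) * 1       ∎
  [1+k]*[1+n]C[1+k]≡[1+n]*nCk (suc n) (suc k) = begin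
    suc (suc k) * (suc (suc n) C suc (suc k))
      ≡⟨ cong (suc (suc k) *_) (pascal (suc n) (suc k)) ⟩
    suc (suc k) * (suc n C suc k + suc n C suc (suc k))
      ≡⟨ regroup (suc k) (suc n C suc k) (suc n C suc (suc k)) ⟩
    suc n C suc k + (suc k * (suc n C suc k) + suc (suc k) * (suc n C suc (suc k)))
      ≡⟨ cong₂ (λ a b → suc n C suc k + (a + b))
               ([1+k]*[1+n]C[1+k]≡[1+n]*nCk n k) ([1+k]*[1+n]C[1+k]≡[1+n]*nCk n (suc k)) ⟩
    suc n C suc k + (suc n * (n C k) + suc n * (n C suc k))
      ≡⟨ cong (suc n C suc k +_) (*-distribˡ-+ (suc n) (n C k) (n C suc k)) ⟨
    suc n C suc k + suc n * (n C k + n C suc k)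
      ≡⟨ cong (λ c → suc n C suc k + suc n * c) (pascal n k) ⟨
    suc n C suc k + suc n * (suc n C suc k)
      ∎
    where
    regroup : ∀ k a b → (1 + k) * (a + b) ≡ a + (k * a + (1 + k) * b)
    regroup = solve-∀

  partialRowSum-suc : ∀ M N → partialRowSum (suc M) (suc N) ≡ 2 * partialRowSum M N + M C N
  partialRowSum-suc M zero    = refl
  partialRowSum-suc M (suc N) = begin
    partialRowSum (suc M) (suc N) + suc M C suc N
      ≡⟨ cong₂ _+_ (partialRowSum-suc M N) (pascal M N) ⟩
    2 * partialRowSum M N + M C N + (M C N + M C suc N)
      ≡⟨ regroup (partialRowSum M N) (M C N) (M C suc N) ⟩
    2 * (partialRowSum M N + M C N) + M C suc N
      ∎
    where
    regroup : ∀ s a b → 2 * s + a + (a + b) ≡ 2 * (s + a) + b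
    regroup = solve-∀

  weightedRowSum-suc : ∀ M r →
    weightedRowSum M (suc r) ≡ weightedRowSum M r + partialRowSum M (suc (suc r))
  weightedRowSum-suc M r = begin
    (∑[ j < suc r ] (suc r ∸ j + 1) * (M C j)) + (r ∸ r + 1) * (M C suc r)
      ≡⟨ cong₂ _+_ (∑<-cong (suc r) split) (cong (λ t → (t + 1) * (M C suc r)) (n∸n≡0 r)) ⟩
    (∑[ j < suc r ] (r ∸ j + 1) * (M C j) + M C j) + (0 + 1) * (M C suc r)
      ≡⟨ cong₂ _+_ (∑<-distrib-+ (λ j → (r ∸ j + 1) * (M C j)) (M C_) (suc r))
                   (*-identityˡ (M C suc r)) ⟩
    weightedRowSum M r + partialRowSum M (suc r) + M C suc r
      ≡⟨ +-assoc (weightedRowSum M r) (partialRowSum M (suc r)) (M C suc r) ⟩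
    weightedRowSum M r + partialRowSum M (suc (suc r))
      ∎
    where
    split : ∀ j → j < suc r → (suc r ∸ j + 1) * (M C j) ≡ (r ∸ j + 1) * (M C j) + M C j
    split j (s≤s j≤r) = begin
      (suc r ∸ j + 1) * (M C j)     ≡⟨ cong (λ t → (t + 1) * (M C j)) (+-∸-assoc 1 j≤r) ⟩
      (suc (r ∸ j) + 1) * (M C j)   ≡⟨ regroup (r ∸ j) (M C j) ⟩
      (r ∸ j + 1) * (M C j) + M C j ∎
      where
      regroup : ∀ t c → (suc t + 1) * c ≡ (t + 1) * c + c
      regroup = solve-∀

  weightedRowSum-partialRowSum : ∀ M r →
    weightedRowSum (suc M) r + suc M * partialRowSum M r ≡ suc r * partialRowSum (suc M) (suc r)
  weightedRowSum-partialRowSum M zero    = cong (1 +_) (*-zeroʳ M)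
  weightedRowSum-partialRowSum M (suc r) = begin
    weightedRowSum (suc M) (suc r) + suc M * (S + M C r)
      ≡⟨ cong (_+ suc M * (S + M C r)) (weightedRowSum-suc (suc M) r) ⟩
    W + (S′ + c) + suc M * (S + M C r)
      ≡⟨ regroup W S′ c (suc M) S (M C r) ⟩
    (W + suc M * S) + S′ + c + suc M * (M C r)
      ≡⟨ cong₂ (λ a b → a + S′ + c + b)
               (weightedRowSum-partialRowSum M r) (sym ([1+k]*[1+n]C[1+k]≡[1+n]*nCk M r)) ⟩
    suc r * S′ + S′ + c + suc r * c
      ≡⟨ collect (suc r) S′ c ⟩
    suc (suc r) * (S′ + c)
      ∎
    where
    W S S′ c : ℕ
    W  = weightedRowSum (suc M) r
    S  = partialRowSum M r
    S′ = partialRowSum (suc M) (suc r)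
    c  = suc M C suc r
    regroup : ∀ w s′ c m s a → w + (s′ + c) + m * (s + a) ≡ (w + m * s) + s′ + c + m * a
    regroup = solve-∀
    collect : ∀ t s c → t * s + s + c + t * c ≡ (1 + t) * (s + c)
    collect = solve-∀

  d-weightedRowSum : ∀ k r → d (2 * k + r) k ≡ weightedRowSum (suc (r + k)) r
  d-weightedRowSum k r = begin
    sum (map term (upTo (suc (2 * k + r) ∸ 2 * k)))
      ≡⟨ cong (λ N → sum (map term (upTo N))) length ⟩
    sum (map term (upTo (suc r)))
      ≡⟨ sum-map-upTo term (suc r) ⟩
    ∑< term (suc r)
      ≡⟨ ∑<-cong (suc r) (λ j _ → term≡ j) ⟩
    weightedRowSum (suc (r + k)) r
      ∎
    where
    term : ℕ → ℕ
    term j = (2 * k + r ∸ (2 * k + j) + 1) * ((2 * k + r ∸ k + 1) C (2 * k + j ∸ 2 * k))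
    length : suc (2 * k + r) ∸ 2 * k ≡ suc r
    length = trans (cong (_∸ 2 * k) (sym (+-suc (2 * k) r))) (m+n∸m≡n (2 * k) (suc r))
    row : 2 * k + r ∸ k + 1 ≡ suc (r + k)
    row = begin
      2 * k + r ∸ k + 1     ≡⟨ cong (λ t → t ∸ k + 1) (regroup k r) ⟩
      k + (k + r) ∸ k + 1   ≡⟨ cong (_+ 1) (m+n∸m≡n k (k + r)) ⟩
      k + r + 1             ≡⟨ +-comm (k + r) 1 ⟩
      suc (k + r)           ≡⟨ cong suc (+-comm k r) ⟩
      suc (r + k)           ∎
      where
      regroup : ∀ k r → 2 * k + r ≡ k + (k + r)
      regroup = solve-∀
    term≡ : ∀ j → term j ≡ (r ∸ j + 1) * (suc (r + k) C j)
    term≡ j rewrite m+n∸m≡n (2 * k) j =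
      cong₂ (λ a b → (a + 1) * (b C j)) ([m+n]∸[m+o]≡n∸o (2 * k) r j) row

module IntegerSigns where

  open import Data.Nat.Base using (z≤n)
  open import Data.Integer
  open import Data.Integer.Properties
  open import Relation.Binary.PropositionalEquality using (sym; subst)

  private
    variable i j : ℤ

  0≤* : 0ℤ ≤ i → 0ℤ ≤ j → 0ℤ ≤ i * j
  0≤* {j = j} 0≤i 0≤j = *-monoʳ-≤-nonNeg j {{nonNegative 0≤j}} 0≤i

  0<* : 0ℤ < i → 0ℤ < j → 0ℤ < i * j
  0<* {j = j} 0<i 0<j = *-monoʳ-<-pos j {{positive 0<j}} 0<i

  0≤i*i : ∀ i → 0ℤ ≤ i * i
  0≤i*i (+ n)    = 0≤* {+ n} {+ n} (+≤+ z≤n) (+≤+ z≤n)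
  0≤i*i -[1+ n ] = +≤+ z≤n

  0<-cancelˡ : 0ℤ ≤ i → 0ℤ < i * j → 0ℤ < j
  0<-cancelˡ {i} {j} 0≤i 0<ij =
    *-cancelˡ-<-nonNeg i {{nonNegative 0≤i}} (subst (_< i * j) (sym (*-zeroʳ i)) 0<ij)

  0≤-cancelˡ : 0ℤ < i → 0ℤ ≤ i * j → 0ℤ ≤ j
  0≤-cancelˡ {i} {j} 0<i 0≤ij =
    *-cancelˡ-≤-pos 0ℤ j i {{positive 0<i}} (subst (_≤ i * j) (sym (*-zeroʳ i)) 0≤ij)

module PolynomialExpressions where

  open import Data.Nat using (ℕ; zero; suc; z≤n)
  open import Data.Integer using (ℤ; +_; +≤+; 0ℤ; _≤_)
  open import Data.Integer.Properties using (+-mono-≤; ≤-refl)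
  open import Data.List using (List; []; _∷_)
  open import Data.Vec using ([]; _∷_)
  open import Data.Fin using (zero; suc)
  open import Data.Integer.Solver using (module +-*-Solver)
  open +-*-Solver using (Polynomial; ⟦_⟧; con; var; _:+_; _:*_)
  open IntegerSigns using (0≤*)

  private variable m : ℕ

  #_ : ℕ → Polynomial m
  # n = con (+ n)

  -- Polynomials are kept as ring-solver syntax: eval₂ turns them into functions, and identities
  -- between these functions are instances of solve.
  Poly₂ : Set
  Poly₂ = ∀ {m} → Polynomial m → Polynomial m → Polynomial m

  eval₂ : Poly₂ → ℤ → ℤ → ℤ
  eval₂ f k p = ⟦ f (var zero) (var (suc zero)) ⟧ (k ∷ p ∷ [])

  -- Row i of a coefficient array lists the coefficients of kⁱp⁰, kⁱp¹, kⁱp², …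
  Coeffs₂ : Set
  Coeffs₂ = List (List ℕ)

  horner : List ℕ → Polynomial m → Polynomial m
  horner []       x = # 0
  horner (c ∷ cs) x = # c :+ x :* horner cs x

  horner₂ : Coeffs₂ → Poly₂
  horner₂ []       k p = # 0
  horner₂ (r ∷ rs) k p = horner r p :+ k :* horner₂ rs k p

  horner-nonNeg : ∀ cs (x : Polynomial m) ρ → 0ℤ ≤ ⟦ x ⟧ ρ → 0ℤ ≤ ⟦ horner cs x ⟧ ρ
  horner-nonNeg []       x ρ 0≤x = ≤-refl
  horner-nonNeg (c ∷ cs) x ρ 0≤x = +-mono-≤ (+≤+ z≤n) (0≤* 0≤x (horner-nonNeg cs x ρ 0≤x))

  horner₂-nonNeg : ∀ cs k p → 0ℤ ≤ k → 0ℤ ≤ p → 0ℤ ≤ eval₂ (horner₂ cs) k p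
  horner₂-nonNeg []       k p 0≤k 0≤p = ≤-refl
  horner₂-nonNeg (r ∷ rs) k p 0≤k 0≤p =
    +-mono-≤ (horner-nonNeg r (var (suc zero)) (k ∷ p ∷ []) 0≤p)
             (0≤* 0≤k (horner₂-nonNeg rs k p 0≤k 0≤p))

module Recurrence where

  open import Data.Nat as ℕ using (ℕ; suc)
  open import Data.Nat.Combinatorics using (_C_)
  open import Data.Integer using (ℤ; +_; 0ℤ; _+_; _*_; _-_)
  open import Data.Integer.Properties using (pos-+; pos-*; i≡j⇒i-j≡0; i-j≡0⇒i≡j)
  open import Data.Integer.Solver using (module +-*-Solver)
  open import Relation.Binary.PropositionalEquality
    using (_≡_; refl; sym; trans; cong; cong₂; module ≡-Reasoning)
  open ≡-Reasoning
  open +-*-Solver using (solve; _:+_; _:*_; _:-_; _:=_)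
  open PolynomialExpressions using (#_; Poly₂; eval₂)
  open BinomialSums

  Sₛ Pₛ Qₛ : Poly₂
  Sₛ k p = # 1 :+ p
  Pₛ k p = k :+ # 3 :* p :+ # 4
  Qₛ k p = # 2 :* (k :+ p :+ # 1)

  S P Q : ℤ → ℤ → ℤ
  S = eval₂ Sₛ
  P = eval₂ Pₛ
  Q = eval₂ Qₛ

  module _ (k : ℤ) (B c D : ℕ → ℤ)
    (B-suc : ∀ r → B (suc r) ≡ + 2 * B r + c r)
    (c-suc : ∀ r → + suc r * c (suc r) ≡ (+ suc r + k) * c r)
    (D-B   : ∀ r → D r + (+ suc r + k) * B r ≡ + suc r * B (suc r))
    where

    private
      D-closed : ∀ r → D r ≡ + suc r * B (suc r) - (+ suc r + k) * B r
      D-closed r = trans (sym (add-sub (D r) ((+ suc r + k) * B r)))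
                         (cong (_- (+ suc r + k) * B r) (D-B r))
        where
        add-sub : ∀ a b → a + b - b ≡ a
        add-sub = solve 2 (λ a b → a :+ b :- b := a) refl

    -- After eliminating D and B, what is left is a combination of c-suc at r and at r + 1.
    three-term-recurrence : ∀ r → let p = + suc r in
      S k p * D (suc (suc r)) ≡ P k p * D (suc r) - Q k p * D r
    three-term-recurrence r
      rewrite D-closed (suc (suc r)) | D-closed (suc r) | D-closed r
            | B-suc (suc (suc r)) | B-suc (suc r) | B-suc r
      = ≡-by-combination (+ 3 + + r) (+ 2 + + r + k)
          (solve 6 (λ r k b c₀ c₁ c₂ →
             let p  = # 1 :+ r
                 b₁ = # 2 :* b  :+ c₀
                 b₂ = # 2 :* b₁ :+ c₁
                 b₃ = # 2 :* b₂ :+ c₂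
                 d₀ = (# 1 :+ r) :* b₁ :- (# 1 :+ r :+ k) :* b
                 d₁ = (# 2 :+ r) :* b₂ :- (# 2 :+ r :+ k) :* b₁
                 d₂ = (# 3 :+ r) :* b₃ :- (# 3 :+ r :+ k) :* b₂
             in  Sₛ k p :* d₂ :- (Pₛ k p :* d₁ :- Qₛ k p :* d₀)
                 := (# 3 :+ r) :* ((# 2 :+ r) :* c₂ :- (# 2 :+ r :+ k) :* c₁)
                    :- (# 2 :+ r :+ k) :* ((# 1 :+ r) :* c₁ :- (# 1 :+ r :+ k) :* c₀))
             refl (+ r) k (B r) (c r) (c (suc r)) (c (suc (suc r))))
          (i≡j⇒i-j≡0 (c-suc (suc r))) (i≡j⇒i-j≡0 (c-suc r))
      where
      ≡-by-combination : ∀ {L R e₁ e₂} a b → L - R ≡ a * e₁ - b * e₂ → e₁ ≡ 0ℤ → e₂ ≡ 0ℤ → L ≡ R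
      ≡-by-combination {L} {R} a b eq refl refl =
        i-j≡0⇒i≡j L R (trans eq (solve 2 (λ a b → a :* # 0 :- b :* # 0 := # 0) refl a b))

  dℤ : ℕ → ℕ → ℤ
  dℤ k r = + d (2 ℕ.* k ℕ.+ r) k

  module _ (k : ℕ) where

    private
      B c : ℕ → ℤ
      B r = + partialRowSum (r ℕ.+ k) r
      c r = + ((r ℕ.+ k) C r)

      B-suc : ∀ r → B (suc r) ≡ + 2 * B r + c r
      B-suc r = begin
        + partialRowSum (suc (r ℕ.+ k)) (suc r) ≡⟨ cong +_ (partialRowSum-suc (r ℕ.+ k) r) ⟩
        + (2 ℕ.* b ℕ.+ (r ℕ.+ k) C r)           ≡⟨ pos-+ (2 ℕ.* b) _ ⟩
        + (2 ℕ.* b) + c r                       ≡⟨ cong (_+ c r) (pos-* 2 b) ⟩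
        + 2 * B r + c r                         ∎
        where b = partialRowSum (r ℕ.+ k) r

      c-suc : ∀ r → + suc r * c (suc r) ≡ (+ suc r + + k) * c r
      c-suc r = begin
        + suc r * c (suc r)                   ≡⟨ pos-* (suc r) _ ⟨
        + (suc r ℕ.* (suc (r ℕ.+ k) C suc r)) ≡⟨ cong +_ ([1+k]*[1+n]C[1+k]≡[1+n]*nCk (r ℕ.+ k) r) ⟩
        + (suc (r ℕ.+ k) ℕ.* ((r ℕ.+ k) C r)) ≡⟨ pos-* (suc (r ℕ.+ k)) _ ⟩
        (+ suc r + + k) * c r                 ∎

      D-B : ∀ r → dℤ k r + (+ suc r + + k) * B r ≡ + suc r * B (suc r)
      D-B r = begin
        dℤ k r + (+ suc r + + k) * B r
          ≡⟨ cong₂ _+_ (cong +_ (sym (d-weightedRowSum k r))) (pos-* (suc (r ℕ.+ k)) _) ⟨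
        + w + + (suc (r ℕ.+ k) ℕ.* partialRowSum (r ℕ.+ k) r)
          ≡⟨ pos-+ w _ ⟨
        + (w ℕ.+ suc (r ℕ.+ k) ℕ.* partialRowSum (r ℕ.+ k) r)
          ≡⟨ cong +_ (weightedRowSum-partialRowSum (r ℕ.+ k) r) ⟩
        + (suc r ℕ.* partialRowSum (suc (r ℕ.+ k)) (suc r))
          ≡⟨ pos-* (suc r) _ ⟩
        + suc r * B (suc r) ∎
        where w = weightedRowSum (suc (r ℕ.+ k)) r

    d-recurrence : ∀ r → let p = + suc r in
      S (+ k) p * dℤ k (suc (suc r)) ≡ P (+ k) p * dℤ k (suc r) - Q (+ k) p * dℤ k r
    d-recurrence = three-term-recurrence (+ k) B c (dℤ k) B-suc c-suc D-B

module QuadraticForms where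

  open import Data.Nat.Base using (z≤n)
  open import Data.Integer
  open import Data.Integer.Properties
  open import Data.Integer.Solver using (module +-*-Solver)
  open import Relation.Binary.PropositionalEquality
    using (_≡_; refl; sym; subst; cong; cong₂; module ≡-Reasoning)
  open import Relation.Nullary using (yes; no; contradiction)
  open +-*-Solver using (Polynomial; solve; _:+_; _:*_; _:-_; :-_; _:=_; con)
  open IntegerSigns

  form : ℤ → ℤ → ℤ → ℤ → ℤ → ℤ
  form a b c x w = a * x * x + b * x * w + c * w * w

  formₛ : ∀ {m} → Polynomial m → Polynomial m → Polynomial m → Polynomial m → Polynomial m → Polynomial m
  formₛ a b c x w = a :* x :* x :+ b :* x :* w :+ c :* w :* w

  polar : ℤ → ℤ → ℤ → ℤ → ℤ
  polar a b x w = + 2 * a * x + b * w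

  form-secant : ∀ a b c x w v u →
    u * u * form a b c x w + w * w * - form a b c v u ≡
      (u * x - v * w) * (u * polar a b x w - a * (u * x - v * w))
  form-secant = solve 7 (λ a b c x w v u →
    u :* u :* formₛ a b c x w :+ w :* w :* :- formₛ a b c v u
    := (u :* x :- v :* w) :* (u :* (con (+ 2) :* a :* x :+ b :* w) :- a :* (u :* x :- v :* w)))
    refl

  polar-pos : ∀ a b c {x w v u} → 0ℤ ≤ a → 0ℤ < u → 0ℤ < w → form a b c v u < 0ℤ →
    0ℤ ≤ u * x - v * w → 0ℤ ≤ form a b c x w → 0ℤ < polar a b x w
  polar-pos a b c {x} {w} {v} {u} 0≤a 0<u 0<w Ψvu<0 0≤s 0≤Ψxw =
    0<-cancelˡ (<⇒≤ 0<u) (subst (0ℤ <_) (sym (split u (polar a b x w) a s)) 0<uV)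
    where
    s t : ℤ
    s = u * x - v * w
    t = u * polar a b x w - a * s
    0<st : 0ℤ < s * t
    0<st = subst (0ℤ <_) (form-secant a b c x w v u)
      (+-mono-≤-< (0≤* (0≤i*i u) 0≤Ψxw) (0<* (0<* 0<w 0<w) (neg-mono-< Ψvu<0)))
    0<uV : 0ℤ < t + a * s
    0<uV = +-mono-<-≤ (0<-cancelˡ 0≤s 0<st) (0≤* 0≤a 0≤s)
    split : ∀ u V a s → u * V ≡ (u * V - a * s) + a * s
    split = solve 4 (λ u V a s → u :* V := (u :* V :- a :* s) :+ a :* s) refl

  right-of-root : ∀ a b c {x w v u} → 0ℤ < a → 0ℤ ≤ u → form a b c v u ≤ 0ℤ →
    0ℤ ≤ form a b c x w → 0ℤ ≤ polar a b x w → 0ℤ ≤ u * x - v * w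
  right-of-root a b c {x} {w} {v} {u} 0<a 0≤u Ψvu≤0 0≤Ψxw 0≤V with 0ℤ ≤? u * x - v * w
  ... | yes 0≤s = 0≤s
  ... | no  0≰s = contradiction (0≤-cancelˡ 0<t (subst (0ℤ ≤_) (*-comm s t) 0≤st)) 0≰s
    where
    s t : ℤ
    s = u * x - v * w
    t = u * polar a b x w - a * s
    0≤st : 0ℤ ≤ s * t
    0≤st = subst (0ℤ ≤_) (form-secant a b c x w v u)
      (+-mono-≤ (0≤* (0≤i*i u) 0≤Ψxw) (0≤* (0≤i*i w) (neg-mono-≤ Ψvu≤0)))
    0<t : 0ℤ < t
    0<t = subst (0ℤ <_) (sym (flip u (polar a b x w) a s))
      (+-mono-≤-< (0≤* 0≤u 0≤V) (0<* 0<a (neg-mono-< (≰⇒> 0≰s))))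
      where
      flip : ∀ u V a s → u * V - a * s ≡ u * V + a * - s
      flip = solve 4 (λ u V a s → u :* V :- a :* s := u :* V :+ a :* :- s) refl

  discriminant-nonNeg : ∀ a b c v → 0ℤ ≤ a → form a b c v 1ℤ ≤ 0ℤ → 0ℤ ≤ b * b - + 4 * a * c
  discriminant-nonNeg a b c v 0≤a Ψv1≤0 = subst (0ℤ ≤_) (sym (completing-square a b c v))
    (+-mono-≤ (0≤i*i (polar a b v 1ℤ)) (0≤* (0≤* {+ 4} (+≤+ z≤n) 0≤a) (neg-mono-≤ Ψv1≤0)))
    where
    completing-square : ∀ a b c v →
      b * b - + 4 * a * c ≡ polar a b v 1ℤ * polar a b v 1ℤ + + 4 * a * - form a b c v 1ℤ
    completing-square = solve 4 (λ a b c v →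
      b :* b :- con (+ 4) :* a :* c
      := (con (+ 2) :* a :* v :+ b :* con 1ℤ) :* (con (+ 2) :* a :* v :+ b :* con 1ℤ)
         :+ con (+ 4) :* a :* :- formₛ a b c v (con 1ℤ))
      refl

  polar²-discriminant : ∀ a b c x w →
    polar a b x w * polar a b x w - (b * b - + 4 * a * c) * (w * w) ≡ + 4 * a * form a b c x w
  polar²-discriminant = solve 5 (λ a b c x w →
    (con (+ 2) :* a :* x :+ b :* w) :* (con (+ 2) :* a :* x :+ b :* w)
      :- (b :* b :- con (+ 4) :* a :* c) :* (w :* w)
    := con (+ 4) :* a :* formₛ a b c x w) refl

  form-scale : ∀ a b c s x y → form a b c (s * x) (s * y) ≡ s * s * form a b c x y
  form-scale = solve 6 (λ a b c s x y →
    formₛ a b c (s :* x) (s :* y) := s :* s :* formₛ a b c x y) refl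

  form-∘-linear : ∀ {a b c a′ b′ c′ P Q S F X u v} →
    form a′ b′ c′ P S ≡ F * X →
    a * (+ 2 * a′ * P * Q + b′ * Q * S) ≡ - (F * (X * b + u)) →
    a * (a′ * Q * Q) ≡ F * (X * c - v) →
    ∀ x w → a * form a′ b′ c′ (P * x - Q * w) (S * x) ≡ F * (X * form a b c x w + w * (u * x - v * w))
  form-∘-linear {a} {b} {c} {a′} {b′} {c′} {P} {Q} {S} {F} {X} {u} {v} xx xw ww x w = begin
    a * form a′ b′ c′ (P * x - Q * w) (S * x)
      ≡⟨ expand a a′ b′ c′ P Q S x w ⟩
    coefficients (form a′ b′ c′ P S) (a * (+ 2 * a′ * P * Q + b′ * Q * S)) (a * (a′ * Q * Q))
      ≡⟨ cong₂ (λ A B → coefficients A B (a * (a′ * Q * Q))) xx xw ⟩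
    coefficients (F * X) (- (F * (X * b + u))) (a * (a′ * Q * Q))
      ≡⟨ cong (coefficients (F * X) (- (F * (X * b + u)))) ww ⟩
    coefficients (F * X) (- (F * (X * b + u))) (F * (X * c - v))
      ≡⟨ collect F X a b c u v x w ⟩
    F * (X * form a b c x w + w * (u * x - v * w))
      ∎
    where
    open ≡-Reasoning
    coefficients : ℤ → ℤ → ℤ → ℤ
    coefficients A B C = a * A * x * x - B * x * w + C * w * w
    expand : ∀ a a′ b′ c′ P Q S x w → a * form a′ b′ c′ (P * x - Q * w) (S * x) ≡
      a * form a′ b′ c′ P S * x * x - a * (+ 2 * a′ * P * Q + b′ * Q * S) * x * w
        + a * (a′ * Q * Q) * w * w
    expand = solve 9 (λ a a′ b′ c′ P Q S x w →
      a :* formₛ a′ b′ c′ (P :* x :- Q :* w) (S :* x)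
      := a :* formₛ a′ b′ c′ P S :* x :* x
         :- a :* (con (+ 2) :* a′ :* P :* Q :+ b′ :* Q :* S) :* x :* w :+ a :* (a′ :* Q :* Q) :* w :* w)
      refl
    collect : ∀ F X a b c u v x w →
      a * (F * X) * x * x - - (F * (X * b + u)) * x * w + F * (X * c - v) * w * w ≡
      F * (X * form a b c x w + w * (u * x - v * w))
    collect = solve 9 (λ F X a b c u v x w →
      a :* (F :* X) :* x :* x :- :- (F :* (X :* b :+ u)) :* x :* w :+ F :* (X :* c :- v) :* w :* w
      := F :* (X :* formₛ a b c x w :+ w :* (u :* x :- v :* w)))
      refl

module Coefficients where

  open import Data.Nat as ℕ using (ℕ; suc; z≤n; s≤s)
  open import Data.Integer hiding (suc)
  open import Data.Integer.Properties
  open import Data.List using ([]; _∷_)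
  open import Relation.Binary.PropositionalEquality using (_≡_; refl)
  open import Data.Integer.Solver using (module +-*-Solver)
  open +-*-Solver using (solve; _:+_; _:*_; _:-_; :-_; _:=_)
  open IntegerSigns
  open PolynomialExpressions
  open QuadraticForms
  open Recurrence using (S; P; Q; Sₛ; Pₛ; Qₛ)

  -- In the coordinates k and p = n − 2k: α = Xden/2, β = −Xrat·Xden and y = β² − 4αγ.
  -- Dividing α·Ψ_{p+1}(Px − Qw, Sx) by Ψ_p(x, w) as polynomials in x leaves the quotient F·X₂
  -- and the remainder F·w·(ux − vw); then H = −Ψ_p(v, u)/α.
  β⁺ γ⁺ X₂⁺ u⁺ v⁺ H⁺ : Coeffs₂

  β⁺ =
      (0 ∷ 12 ∷ 24 ∷ 12 ∷ [])
    ∷ (9 ∷ 21 ∷ 16 ∷ [])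
    ∷ (6 ∷ 7 ∷ [])
    ∷ (1 ∷ [])
    ∷ []

  γ⁺ =
      (0 ∷ 8 ∷ 16 ∷ 8 ∷ [])
    ∷ (6 ∷ 22 ∷ 16 ∷ [])
    ∷ (10 ∷ 10 ∷ [])
    ∷ (2 ∷ [])
    ∷ []

  X₂⁺ =
      (0 ∷ 32 ∷ 34 ∷ 8 ∷ [])
    ∷ (4 ∷ 20 ∷ 8 ∷ [])
    ∷ (0 ∷ 2 ∷ [])
    ∷ []

  u⁺ =
      (0 ∷ 0 ∷ 0 ∷ 8 ∷ 16 ∷ 8 ∷ [])
    ∷ (0 ∷ 144 ∷ 242 ∷ 150 ∷ 40 ∷ [])
    ∷ (36 ∷ 212 ∷ 214 ∷ 66 ∷ [])
    ∷ (24 ∷ 84 ∷ 40 ∷ [])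
    ∷ (4 ∷ 8 ∷ [])
    ∷ []

  v⁺ =
      (0 ∷ 0 ∷ 16 ∷ 48 ∷ 48 ∷ 16 ∷ [])
    ∷ (0 ∷ 104 ∷ 276 ∷ 252 ∷ 80 ∷ [])
    ∷ (24 ∷ 284 ∷ 368 ∷ 132 ∷ [])
    ∷ (40 ∷ 152 ∷ 80 ∷ [])
    ∷ (8 ∷ 16 ∷ [])
    ∷ []

  H⁺ =
      []
    ∷ (0 ∷ 0 ∷ 4608 ∷ 23040 ∷ 47232 ∷ 50688 ∷ 29952 ∷ 9216 ∷ 1152 ∷ [])
    ∷ (0 ∷ 4608 ∷ 45936 ∷ 137952 ∷ 191664 ∷ 137088 ∷ 48960 ∷ 6912 ∷ [])
    ∷ (864 ∷ 32256 ∷ 148536 ∷ 269568 ∷ 234216 ∷ 97344 ∷ 15552 ∷ [])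
    ∷ (5328 ∷ 55872 ∷ 152640 ∷ 174240 ∷ 88848 ∷ 16704 ∷ [])
    ∷ (5328 ∷ 32112 ∷ 56664 ∷ 39168 ∷ 9288 ∷ [])
    ∷ (1584 ∷ 6624 ∷ 7632 ∷ 2592 ∷ [])
    ∷ (144 ∷ 432 ∷ 288 ∷ [])
    ∷ []

  αₛ βₛ γₛ Cₛ Fₛ X₂ₛ uₛ vₛ Hₛ : Poly₂
  αₛ k p = p :* (k :+ # 2 :* p) :* (k :+ # 2 :* p :+ # 3)
  βₛ k p = :- horner₂ β⁺ k p
  γₛ = horner₂ γ⁺
  Cₛ k p = # 2 :* (k :+ # 2 :* p) :* (k :+ # 2 :* p) :+ # 12 :* k :+ # 16 :* p
  Fₛ k p = (# 1 :+ p) :* (k :+ p :+ # 1)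
  X₂ₛ = horner₂ X₂⁺
  uₛ = horner₂ u⁺
  vₛ = horner₂ v⁺
  Hₛ = horner₂ H⁺

  α β γ C F X₂ u v H : ℤ → ℤ → ℤ
  α = eval₂ αₛ
  β = eval₂ βₛ
  γ = eval₂ γₛ
  C = eval₂ Cₛ
  F = eval₂ Fₛ
  X₂ = eval₂ X₂ₛ
  u = eval₂ uₛ
  v = eval₂ vₛ
  H = eval₂ Hₛ

  Ψ : ℤ → ℤ → ℤ → ℤ → ℤ
  Ψ k p = form (α k p) (β k p) (γ k p)

  Ψ-at-2 : ∀ k p → Ψ k p (+ 2) 1ℤ ≡ - C k p
  Ψ-at-2 = solve 2 (λ k p → formₛ (αₛ k p) (βₛ k p) (γₛ k p) (# 2) (# 1) := :- Cₛ k p) refl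

  Ψ-at-v/u : ∀ k p → Ψ k p (v k p) (u k p) ≡ - (α k p * H k p)
  Ψ-at-v/u k p = i-j≡0⇒i≡j _ _ (solve 2 (λ k p →
    formₛ (αₛ k p) (βₛ k p) (γₛ k p) (vₛ k p) (uₛ k p) :- :- (αₛ k p :* Hₛ k p) := # 0) refl k p)

  coeff-xx : ∀ k p → Ψ k (S k p) (P k p) (S k p) ≡ F k p * X₂ k p
  coeff-xx = solve 2 (λ k p → let p′ = Sₛ k p in
    formₛ (αₛ k p′) (βₛ k p′) (γₛ k p′) (Pₛ k p) (Sₛ k p) := Fₛ k p :* X₂ₛ k p) refl

  coeff-xw : ∀ k p → let p′ = S k p in
    α k p * (+ 2 * α k p′ * P k p * Q k p + β k p′ * Q k p * S k p)
      ≡ - (F k p * (X₂ k p * β k p + u k p))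
  coeff-xw = solve 2 (λ k p → let p′ = Sₛ k p in
    αₛ k p :* (# 2 :* αₛ k p′ :* Pₛ k p :* Qₛ k p :+ βₛ k p′ :* Qₛ k p :* Sₛ k p)
    := :- (Fₛ k p :* (X₂ₛ k p :* βₛ k p :+ uₛ k p))) refl

  coeff-ww : ∀ k p → α k p * (α k (S k p) * Q k p * Q k p) ≡ F k p * (X₂ k p * γ k p - v k p)
  coeff-ww = solve 2 (λ k p →
    αₛ k p :* (αₛ k (Sₛ k p) :* Qₛ k p :* Qₛ k p) := Fₛ k p :* (X₂ₛ k p :* γₛ k p :- vₛ k p)) refl

  Ψ-step : ∀ k p x w →
    α k p * Ψ k (S k p) (P k p * x - Q k p * w) (S k p * x) ≡
      F k p * (X₂ k p * Ψ k p x w + w * (u k p * x - v k p * w))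
  Ψ-step k p = form-∘-linear
    {α k p} {β k p} {γ k p} {α k p′} {β k p′} {γ k p′}
    {P k p} {Q k p} {S k p} {F k p} {X₂ k p} {u k p} {v k p}
    (coeff-xx k p) (coeff-xw k p) (coeff-ww k p)
    where
    p′ : ℤ
    p′ = S k p

  Ψ-base : ∀ k → Ψ k 1ℤ (+ 4 + k) 1ℤ ≡ + 4 * k * (k + 1ℤ)
  Ψ-base = solve 1 (λ k →
    formₛ (αₛ k (# 1)) (βₛ k (# 1)) (γₛ k (# 1)) (# 4 :+ k) (# 1) := # 4 :* k :* (k :+ # 1)) refl

  module _ (k r : ℕ) where

    private
      K p : ℤ
      K = + k
      p = + suc r
      0≤K : 0ℤ ≤ K
      0≤K = +≤+ z≤n

    k+2p-pos : 0ℤ < K + + 2 * p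
    k+2p-pos = +-mono-≤-< 0≤K (+<+ (s≤s z≤n))

    α-pos : 0ℤ < α K p
    α-pos = 0<* {p * (K + + 2 * p)} (0<* {p} (+<+ (s≤s z≤n)) k+2p-pos) (+-mono-<-≤ k+2p-pos (+≤+ z≤n))

    C-pos : 0ℤ < C K p
    C-pos = +-mono-≤-< (+-mono-≤ (0≤* {+ 2 * (K + + 2 * p)} (0≤* {+ 2} (+≤+ z≤n) 0≤K+2p) 0≤K+2p)
                                 (0≤* {+ 12} (+≤+ z≤n) 0≤K))
                       (+<+ (s≤s z≤n))
      where
      0≤K+2p : 0ℤ ≤ K + + 2 * p
      0≤K+2p = <⇒≤ k+2p-pos

    F-nonNeg : 0ℤ ≤ F K p
    F-nonNeg = 0≤* {+ 1 + p} {K + p + + 1} (+≤+ z≤n) (+≤+ z≤n)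

    X₂-nonNeg : 0ℤ ≤ X₂ K p
    X₂-nonNeg = horner₂-nonNeg X₂⁺ K p 0≤K (+≤+ z≤n)

    u-nonNeg : 0ℤ ≤ u K p
    u-nonNeg = horner₂-nonNeg u⁺ K p 0≤K (+≤+ z≤n)

    H-nonNeg : 0ℤ ≤ H K p
    H-nonNeg = horner₂-nonNeg H⁺ K p 0≤K (+≤+ z≤n)

module RatioInvariant where

  open import Data.Nat as ℕ using (ℕ; zero; suc; z≤n; s≤s)
  open import Data.Nat.Properties using () renaming (*-identityˡ to ℕ-*-identityˡ)
  open import Data.Nat.Combinatorics using (nC1≡n)
  open import Data.Integer hiding (suc)
  open import Data.Integer.Properties
  open import Relation.Binary.PropositionalEquality
    using (_≡_; refl; sym; trans; subst; subst₂; cong; module ≡-Reasoning)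
  open import Data.Integer.Solver using (module +-*-Solver)
  open +-*-Solver using (solve; _:+_; _:*_; _:-_; _:=_)
  open IntegerSigns
  open PolynomialExpressions using (#_)
  open QuadraticForms
  open Recurrence
  open Coefficients
  open BinomialSums using (d-weightedRowSum)

  module _ (k r : ℕ) where

    private
      K p : ℤ
      K = + k
      p = + suc r
      0<S : 0ℤ < S K p
      0<S = +<+ (s≤s z≤n)

    Ψ[2,1]<0 : Ψ K p (+ 2) 1ℤ < 0ℤ
    Ψ[2,1]<0 = subst (_< 0ℤ) (sym (Ψ-at-2 K p)) (neg-mono-< (C-pos k r))

    polar-Ψ-pos : ∀ {x w} → 0ℤ ≤ Ψ K p x w → 0ℤ ≤ x - + 2 * w → 0ℤ < w →
      0ℤ < polar (α K p) (β K p) x w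
    polar-Ψ-pos {x} {w} 0≤Ψ 0≤x-2w 0<w =
      polar-pos (α K p) (β K p) (γ K p) (<⇒≤ (α-pos k r)) (+<+ (s≤s z≤n)) 0<w Ψ[2,1]<0
        (subst (λ t → 0ℤ ≤ t - + 2 * w) (sym (*-identityˡ x)) 0≤x-2w) 0≤Ψ

    ratio-≥-v/u : ∀ {x w} → 0ℤ ≤ Ψ K p x w → 0ℤ ≤ polar (α K p) (β K p) x w →
      0ℤ ≤ u K p * x - v K p * w
    ratio-≥-v/u 0≤Ψ 0≤V =
      right-of-root (α K p) (β K p) (γ K p) (α-pos k r) (u-nonNeg k r) Ψ[v,u]≤0 0≤Ψ 0≤V
      where
      Ψ[v,u]≤0 : Ψ K p (v K p) (u K p) ≤ 0ℤ
      Ψ[v,u]≤0 = subst (_≤ 0ℤ) (sym (Ψ-at-v/u K p)) (neg-mono-≤ (0≤* (<⇒≤ (α-pos k r)) (H-nonNeg k r)))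

    module _ {x w x′ : ℤ} (step : S K p * x′ ≡ P K p * x - Q K p * w)
             (0≤Ψ : 0ℤ ≤ Ψ K p x w) (0≤x-2w : 0ℤ ≤ x - + 2 * w) (0<w : 0ℤ < w) where

      Ψ-next-nonNeg : 0ℤ ≤ Ψ K (S K p) x′ x
      Ψ-next-nonNeg =
        0≤-cancelˡ (0<* 0<S 0<S) (0≤-cancelˡ (α-pos k r) (subst (0ℤ ≤_) (sym rescaled) 0≤rhs))
        where
        open ≡-Reasoning
        p′ : ℤ
        p′ = S K p
        rescaled : α K p * (S K p * S K p * Ψ K p′ x′ x) ≡
                   F K p * (X₂ K p * Ψ K p x w + w * (u K p * x - v K p * w))
        rescaled = begin
          α K p * (S K p * S K p * Ψ K p′ x′ x)
            ≡⟨ cong (α K p *_) (form-scale (α K p′) (β K p′) (γ K p′) (S K p) x′ x) ⟨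
          α K p * Ψ K p′ (S K p * x′) (S K p * x)
            ≡⟨ cong (λ t → α K p * Ψ K p′ t (S K p * x)) step ⟩
          α K p * Ψ K p′ (P K p * x - Q K p * w) (S K p * x)
            ≡⟨ Ψ-step K p x w ⟩
          F K p * (X₂ K p * Ψ K p x w + w * (u K p * x - v K p * w)) ∎
        0≤rhs : 0ℤ ≤ F K p * (X₂ K p * Ψ K p x w + w * (u K p * x - v K p * w))
        0≤rhs = 0≤* (F-nonNeg k r) (+-mono-≤ (0≤* (X₂-nonNeg k r) 0≤Ψ)
          (0≤* (<⇒≤ 0<w) (ratio-≥-v/u 0≤Ψ (<⇒≤ (polar-Ψ-pos 0≤Ψ 0≤x-2w 0<w)))))

      doubling-next : 0ℤ ≤ x′ - + 2 * x
      doubling-next = 0≤-cancelˡ 0<S (subst (0ℤ ≤_) (sym doubling)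
        (+-mono-≤ (0≤* {K + p + + 2} (+≤+ z≤n) 0≤x-2w) (0≤* {+ 2} (+≤+ z≤n) (<⇒≤ 0<w))))
        where
        open ≡-Reasoning
        doubling : S K p * (x′ - + 2 * x) ≡ (K + p + + 2) * (x - + 2 * w) + + 2 * w
        doubling = begin
          S K p * (x′ - + 2 * x)
            ≡⟨ solve 4 (λ K p x x′ → Sₛ K p :* (x′ :- # 2 :* x) := Sₛ K p :* x′ :- # 2 :* Sₛ K p :* x)
                 refl K p x x′ ⟩
          S K p * x′ - + 2 * S K p * x
            ≡⟨ cong (λ t → t - + 2 * S K p * x) step ⟩
          P K p * x - Q K p * w - + 2 * S K p * x
            ≡⟨ solve 4 (λ K p x w → Pₛ K p :* x :- Qₛ K p :* w :- # 2 :* Sₛ K p :* x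
                 := (K :+ p :+ # 2) :* (x :- # 2 :* w) :+ # 2 :* w) refl K p x w ⟩
          (K + p + + 2) * (x - + 2 * w) + + 2 * w ∎

  twice-pos : ∀ {x w} → 0ℤ ≤ x - + 2 * w → 0ℤ < w → 0ℤ < x
  twice-pos {x} {w} 0≤x-2w 0<w =
    subst (0ℤ <_) (sym (split x w)) (+-mono-≤-< 0≤x-2w (0<* {+ 2} (+<+ (s≤s z≤n)) 0<w))
    where
    split : ∀ x w → x ≡ x - + 2 * w + + 2 * w
    split = solve 2 (λ x w → x := x :- # 2 :* w :+ # 2 :* w) refl

  record Invariant (k r : ℕ) : Set where
    field
      Ψ-nonNeg : 0ℤ ≤ Ψ (+ k) (+ suc r) (dℤ k (suc r)) (dℤ k r)
      doubling : 0ℤ ≤ dℤ k (suc r) - + 2 * dℤ k r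
      d-pos    : 0ℤ < dℤ k r

  invariant : ∀ k r → Invariant k r
  invariant k zero = record
    { Ψ-nonNeg = subst₂ (λ x w → 0ℤ ≤ Ψ (+ k) 1ℤ x w) (sym d₁) (sym d₀)
        (subst (0ℤ ≤_) (sym (Ψ-base (+ k)))
               (0≤* {+ 4 * + k} (0≤* {+ 4} {+ k} (+≤+ z≤n) (+≤+ z≤n)) (+≤+ z≤n)))
    ; doubling = subst₂ (λ x w → 0ℤ ≤ x - + 2 * w) (sym d₁) (sym d₀) (+≤+ z≤n)
    ; d-pos    = subst (0ℤ <_) (sym d₀) (+<+ (s≤s z≤n))
    }
    where
    d₀ : dℤ k 0 ≡ 1ℤ
    d₀ = cong +_ (d-weightedRowSum k 0)
    d₁ : dℤ k 1 ≡ + 4 + + k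
    d₁ = cong +_ (trans (d-weightedRowSum k 1)
                        (cong (2 ℕ.+_) (trans (ℕ-*-identityˡ _) (nC1≡n (2 ℕ.+ k)))))
  invariant k (suc r) = record
    { Ψ-nonNeg = Ψ-next-nonNeg k r (d-recurrence k r) Ψ-nonNeg doubling d-pos
    ; doubling = doubling-next k r (d-recurrence k r) Ψ-nonNeg doubling d-pos
    ; d-pos    = twice-pos doubling d-pos
    }
    where open Invariant (invariant k r)

module RationalEmbedding where

  open import Data.Nat as ℕ using (ℕ; zero; suc)
  open import Data.Integer as ℤ using (+_; -[1+_]; +≤+; +<+)
  import Data.Integer.Properties as ℤ
  open import Data.Rational as ℚ using (ℚ; mkℚ; 0ℚ; 1ℚ; _+_; _*_; _-_; -_; _≤_; _<_)
  open import Data.Rational.Properties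
  import Data.Nat.Coprimality as Coprime
  open import Data.Vec using (Vec; []; _∷_; lookup; map)
  open import Data.Vec.Properties using (lookup-map)
  open import Data.Fin using (zero; suc)
  open import Data.Product using (_,_)
  open import Relation.Binary.PropositionalEquality
  open import Relation.Nullary using (yes; no; contradiction)
  open import Algebra.Solver.Ring using ([+]; [*])
  open import Data.Integer.Solver using (module +-*-Solver)
  open +-*-Solver using (Polynomial; ⟦_⟧; op; con; var; _:^_; :-_)
    renaming (_:+_ to _:+ℤ_; _:*_ to _:*ℤ_; _:-_ to _:-ℤ_)
  import Data.Rational.Solver as ℚ-Solver
  open ℚ-Solver.+-*-Solver using (solve; _:+_; _:*_; _:-_; _:=_)
  open QuadraticForms using (form; polar; polar²-discriminant)
  open IntegerSigns using (0≤*)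

  ℤ→ℚ-mkℚ : ∀ i → ℤ→ℚ i ≡ mkℚ i 0 (Coprime.sym (Coprime.1-coprimeTo ℤ.∣ i ∣))
  ℤ→ℚ-mkℚ i = ↥p/↧p≡p (mkℚ i 0 _)

  ℤ→ℚ-+ : ∀ i j → ℤ→ℚ (i ℤ.+ j) ≡ ℤ→ℚ i + ℤ→ℚ j
  ℤ→ℚ-+ i j = begin
    ℤ→ℚ (i ℤ.+ j)                   ≡⟨ cong ℤ→ℚ (cong₂ ℤ._+_ (ℤ.*-identityʳ i) (ℤ.*-identityʳ j)) ⟨
    ℤ→ℚ (i ℤ.* ℤ.1ℤ ℤ.+ j ℤ.* ℤ.1ℤ) ≡⟨ cong₂ _+_ (ℤ→ℚ-mkℚ i) (ℤ→ℚ-mkℚ j) ⟨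
    ℤ→ℚ i + ℤ→ℚ j                   ∎
    where open ≡-Reasoning

  ℤ→ℚ-* : ∀ i j → ℤ→ℚ (i ℤ.* j) ≡ ℤ→ℚ i * ℤ→ℚ j
  ℤ→ℚ-* i j = sym (cong₂ _*_ (ℤ→ℚ-mkℚ i) (ℤ→ℚ-mkℚ j))

  ℤ→ℚ-neg : ∀ i → ℤ→ℚ (ℤ.- i) ≡ - ℤ→ℚ i
  ℤ→ℚ-neg i = trans (ℤ→ℚ-mkℚ (ℤ.- i)) (trans (neg-mkℚ i) (cong -_ (sym (ℤ→ℚ-mkℚ i))))
    where
    neg-mkℚ : ∀ i → mkℚ (ℤ.- i) 0 (Coprime.sym (Coprime.1-coprimeTo ℤ.∣ ℤ.- i ∣)) ≡
                    - mkℚ i 0 (Coprime.sym (Coprime.1-coprimeTo ℤ.∣ i ∣))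
    neg-mkℚ (+ zero)  = refl
    neg-mkℚ (+ suc n) = refl
    neg-mkℚ -[1+ n ]  = refl

  ℤ→ℚ-nonNeg : ∀ {i} → ℤ.0ℤ ℤ.≤ i → 0ℚ ≤ ℤ→ℚ i
  ℤ→ℚ-nonNeg {+ n} _ = nonNegative⁻¹ _ {{normalize-nonNeg n 1}}

  ℤ→ℚ-pos : ∀ {i} → ℤ.0ℤ ℤ.< i → 0ℚ < ℤ→ℚ i
  ℤ→ℚ-pos {+ zero}  (+<+ ())
  ℤ→ℚ-pos {+ suc n} _ = positive⁻¹ _ {{normalize-pos (suc n) 1}}

  ℤ→ℚ-≢0 : ∀ {i} → ℤ.0ℤ ℤ.< i → ℤ→ℚ i ≢ 0ℚ
  ℤ→ℚ-≢0 0<i = ≢-sym (<⇒≢ (ℤ→ℚ-pos 0<i))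

  private variable m : ℕ

  pow : ℚ → ℕ → ℚ
  pow x zero    = 1ℚ
  pow x (suc n) = x * pow x n

  ⟦_⟧ℚ : Polynomial m → Vec ℚ m → ℚ
  ⟦ op [+] e f ⟧ℚ ρ = ⟦ e ⟧ℚ ρ + ⟦ f ⟧ℚ ρ
  ⟦ op [*] e f ⟧ℚ ρ = ⟦ e ⟧ℚ ρ * ⟦ f ⟧ℚ ρ
  ⟦ con c      ⟧ℚ ρ = ℤ→ℚ c
  ⟦ var x      ⟧ℚ ρ = lookup ρ x
  ⟦ e :^ n     ⟧ℚ ρ = pow (⟦ e ⟧ℚ ρ) n
  ⟦ :- e       ⟧ℚ ρ = - ⟦ e ⟧ℚ ρ

  ℤ→ℚ-⟦⟧ : ∀ (e : Polynomial m) ρ → ℤ→ℚ (⟦ e ⟧ ρ) ≡ ⟦ e ⟧ℚ (map ℤ→ℚ ρ)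
  ℤ→ℚ-⟦⟧ (op [+] e f) ρ = trans (ℤ→ℚ-+ (⟦ e ⟧ ρ) (⟦ f ⟧ ρ)) (cong₂ _+_ (ℤ→ℚ-⟦⟧ e ρ) (ℤ→ℚ-⟦⟧ f ρ))
  ℤ→ℚ-⟦⟧ (op [*] e f) ρ = trans (ℤ→ℚ-* (⟦ e ⟧ ρ) (⟦ f ⟧ ρ)) (cong₂ _*_ (ℤ→ℚ-⟦⟧ e ρ) (ℤ→ℚ-⟦⟧ f ρ))
  ℤ→ℚ-⟦⟧ (con c)      ρ = refl
  ℤ→ℚ-⟦⟧ (var x)      ρ = sym (lookup-map x ℤ→ℚ ρ)
  ℤ→ℚ-⟦⟧ (e :^ n)     ρ = ℤ→ℚ-pow n
    where
    ℤ→ℚ-pow : ∀ n → ℤ→ℚ (⟦ e :^ n ⟧ ρ) ≡ pow (⟦ e ⟧ℚ (map ℤ→ℚ ρ)) n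
    ℤ→ℚ-pow zero    = refl
    ℤ→ℚ-pow (suc n) = trans (ℤ→ℚ-* (⟦ e ⟧ ρ) (⟦ e :^ n ⟧ ρ)) (cong₂ _*_ (ℤ→ℚ-⟦⟧ e ρ) (ℤ→ℚ-pow n))
  ℤ→ℚ-⟦⟧ (:- e)       ρ = trans (ℤ→ℚ-neg (⟦ e ⟧ ρ)) (cong -_ (ℤ→ℚ-⟦⟧ e ρ))

  ÷'-cancel : ∀ p {q} → q ≢ 0ℚ → (p ÷' q) * q ≡ p
  ÷'-cancel p {q} q≢0 with q ≟ 0ℚ
  ... | yes q≡0  = contradiction q≡0 q≢0
  ... | no  q≢0′ = begin
    p * ℚ.1/ q * q   ≡⟨ *-assoc p (ℚ.1/ q) q ⟩
    p * (ℚ.1/ q * q) ≡⟨ cong (p *_) (*-inverseˡ q) ⟩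
    p * 1ℚ           ≡⟨ *-identityʳ p ⟩
    p                ∎
    where
    open ≡-Reasoning
    instance _ = ℚ.≢-nonZero q≢0′

  clear-denominators : ∀ {D₁ D₂ D₃} N₁ N₂ N₃ → D₁ ≢ 0ℚ → D₂ ≢ 0ℚ → D₃ ≢ 0ℚ →
    (ℕ→ℚ 1 ÷' ℕ→ℚ 2) * (ℕ→ℚ 3 + N₁ ÷' D₁ + N₂ ÷' D₂ - N₃ ÷' D₃) * (ℕ→ℚ 2 * D₁ * D₃ * D₂)
      ≡ ℕ→ℚ 3 * D₁ * D₃ * D₂ + N₁ * D₃ * D₂ + N₂ * D₁ * D₃ - N₃ * D₁ * D₂
  clear-denominators {D₁} {D₂} {D₃} N₁ N₂ N₃ D₁≢0 D₂≢0 D₃≢0 = begin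
    I₀ * (ℕ→ℚ 3 + I₁ + I₂ - I₃) * (ℕ→ℚ 2 * D₁ * D₃ * D₂)
      ≡⟨ solve 9 (λ i₀ i₁ i₂ i₃ two three d₁ d₂ d₃ →
           i₀ :* (three :+ i₁ :+ i₂ :- i₃) :* (two :* d₁ :* d₃ :* d₂)
           := i₀ :* two :* (three :* d₁ :* d₃ :* d₂ :+ (i₁ :* d₁) :* d₃ :* d₂
                            :+ (i₂ :* d₂) :* d₁ :* d₃ :- (i₃ :* d₃) :* d₁ :* d₂))
           refl I₀ I₁ I₂ I₃ (ℕ→ℚ 2) (ℕ→ℚ 3) D₁ D₂ D₃ ⟩
    cleared (I₀ * ℕ→ℚ 2) (I₁ * D₁) (I₂ * D₂) (I₃ * D₃)
      ≡⟨ cong₂ (λ a b → cleared a b (I₂ * D₂) (I₃ * D₃))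
               (÷'-cancel (ℕ→ℚ 1) {ℕ→ℚ 2} (λ ())) (÷'-cancel N₁ D₁≢0) ⟩
    cleared 1ℚ N₁ (I₂ * D₂) (I₃ * D₃)
      ≡⟨ cong₂ (cleared 1ℚ N₁) (÷'-cancel N₂ D₂≢0) (÷'-cancel N₃ D₃≢0) ⟩
    cleared 1ℚ N₁ N₂ N₃
      ≡⟨ *-identityˡ _ ⟩
    ℕ→ℚ 3 * D₁ * D₃ * D₂ + N₁ * D₃ * D₂ + N₂ * D₁ * D₃ - N₃ * D₁ * D₂ ∎
    where
    open ≡-Reasoning
    I₀ I₁ I₂ I₃ : ℚ
    I₀ = ℕ→ℚ 1 ÷' ℕ→ℚ 2
    I₁ = N₁ ÷' D₁
    I₂ = N₂ ÷' D₂
    I₃ = N₃ ÷' D₃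
    cleared : ℚ → ℚ → ℚ → ℚ → ℚ
    cleared e a b c = e * (ℕ→ℚ 3 * D₁ * D₃ * D₂ + a * D₃ * D₂ + b * D₁ * D₃ - c * D₁ * D₂)

  private
    0≤-cancelʳ : ∀ {p q} → 0ℚ < q → 0ℚ ≤ p * q → 0ℚ ≤ p
    0≤-cancelʳ {p} {q} 0<q 0≤pq =
      *-cancelʳ-≤-pos q {{ℚ.positive 0<q}} (subst (_≤ p * q) (sym (*-zeroˡ q)) 0≤pq)

    0<* : ∀ {p q} → 0ℚ < p → 0ℚ < q → 0ℚ < p * q
    0<* {p} {q} 0<p 0<q = positive⁻¹ _ {{pos*pos⇒pos p {{ℚ.positive 0<p}} q {{ℚ.positive 0<q}}}}

    x+[y-x]≡y : ∀ x y → x + (y - x) ≡ y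
    x+[y-x]≡y x y = begin
      x + (y - x)   ≡⟨ cong (λ t → x + t) (+-comm y (- x)) ⟩
      x + (- x + y) ≡⟨ +-assoc x (- x) y ⟨
      x - x + y     ≡⟨ cong (_+ y) (+-inverseʳ x) ⟩
      0ℚ + y        ≡⟨ +-identityˡ y ⟩
      y             ∎
      where open ≡-Reasoning

  sqrtLe-discriminant-polar : ∀ a b c {x w} → ℤ.0ℤ ℤ.< w → ℤ.0ℤ ℤ.≤ a →
    ℤ.0ℤ ℤ.≤ b ℤ.* b ℤ.- + 4 ℤ.* a ℤ.* c →
    ℤ.0ℤ ℤ.≤ polar a b x w →
    ℤ.0ℤ ℤ.≤ form a b c x w →
    SqrtLe (ℤ→ℚ (b ℤ.* b ℤ.- + 4 ℤ.* a ℤ.* c)) ((ℤ→ℚ x ÷' ℤ→ℚ w) * ℤ→ℚ (+ 2 ℤ.* a) + ℤ→ℚ b)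
  sqrtLe-discriminant-polar a b c {x} {w} 0<w 0≤a 0≤disc 0≤V 0≤Ψ = ℤ→ℚ-nonNeg 0≤disc , 0≤r , disc≤r²
    where
    open ≡-Reasoning
    disc V : ℤ.ℤ
    disc = b ℤ.* b ℤ.- + 4 ℤ.* a ℤ.* c
    V = polar a b x w
    W ρ r : ℚ
    W = ℤ→ℚ w
    ρ = ℤ→ℚ x ÷' W
    r = ρ * ℤ→ℚ (+ 2 ℤ.* a) + ℤ→ℚ b
    0<W : 0ℚ < W
    0<W = ℤ→ℚ-pos 0<w
    rW≡V : r * W ≡ ℤ→ℚ V
    rW≡V = begin
      (ρ * ℤ→ℚ (+ 2 ℤ.* a) + ℤ→ℚ b) * W
        ≡⟨ solve 4 (λ ρ t B W → (ρ :* t :+ B) :* W := t :* (ρ :* W) :+ B :* W)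
             refl ρ (ℤ→ℚ (+ 2 ℤ.* a)) (ℤ→ℚ b) W ⟩
      ℤ→ℚ (+ 2 ℤ.* a) * (ρ * W) + ℤ→ℚ b * W
        ≡⟨ cong (λ t → ℤ→ℚ (+ 2 ℤ.* a) * t + ℤ→ℚ b * W) (÷'-cancel (ℤ→ℚ x) (ℤ→ℚ-≢0 0<w)) ⟩
      ℤ→ℚ (+ 2 ℤ.* a) * ℤ→ℚ x + ℤ→ℚ b * W
        ≡⟨ ℤ→ℚ-⟦⟧ (var zero :*ℤ var (suc zero) :+ℤ var (suc (suc zero)) :*ℤ var (suc (suc (suc zero))))
                  (+ 2 ℤ.* a ∷ x ∷ b ∷ w ∷ []) ⟨
      ℤ→ℚ V ∎
    0≤r : 0ℚ ≤ r
    0≤r = 0≤-cancelʳ 0<W (subst (0ℚ ≤_) (sym rW≡V) (ℤ→ℚ-nonNeg 0≤V))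
    [r²-disc]W² : (r * r - ℤ→ℚ disc) * (W * W) ≡ ℤ→ℚ (+ 4 ℤ.* a ℤ.* form a b c x w)
    [r²-disc]W² = begin
      (r * r - ℤ→ℚ disc) * (W * W)
        ≡⟨ solve 3 (λ r d W → (r :* r :- d) :* (W :* W) := (r :* W) :* (r :* W) :- d :* (W :* W))
             refl r (ℤ→ℚ disc) W ⟩
      (r * W) * (r * W) - ℤ→ℚ disc * (W * W)
        ≡⟨ cong (λ t → t * t - ℤ→ℚ disc * (W * W)) rW≡V ⟩
      ℤ→ℚ V * ℤ→ℚ V - ℤ→ℚ disc * (W * W)
        ≡⟨ ℤ→ℚ-⟦⟧ (var zero :*ℤ var zero
                     :-ℤ var (suc zero) :*ℤ (var (suc (suc zero)) :*ℤ var (suc (suc zero))))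
                  (V ∷ disc ∷ w ∷ []) ⟨
      ℤ→ℚ (V ℤ.* V ℤ.- disc ℤ.* (w ℤ.* w))
        ≡⟨ cong ℤ→ℚ (polar²-discriminant a b c x w) ⟩
      ℤ→ℚ (+ 4 ℤ.* a ℤ.* form a b c x w) ∎
    disc≤r² : ℤ→ℚ disc ≤ r * r
    disc≤r² = subst₂ _≤_ (+-identityʳ (ℤ→ℚ disc)) (x+[y-x]≡y (ℤ→ℚ disc) (r * r))
      (+-monoʳ-≤ (ℤ→ℚ disc) (0≤-cancelʳ (0<* 0<W 0<W) (subst (0ℚ ≤_) (sym [r²-disc]W²)
        (ℤ→ℚ-nonNeg (0≤* (0≤* {+ 4} (+≤+ ℕ.z≤n) 0≤a) 0≤Ψ)))))

module DefsAsPolynomials where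

  open import Data.Nat as ℕ using (ℕ; suc; z≤n; s≤s)
  open import Data.Integer as ℤ using (+_; +<+; +≤+)
  import Data.Integer.Properties as ℤ
  import Data.Rational as ℚ
  open import Data.Vec using ([]; _∷_)
  open import Data.Fin using (zero; suc)
  open import Relation.Binary.PropositionalEquality using (_≡_; _≢_; refl; sym; trans; subst; cong)
  open import Data.Integer.Solver using (module +-*-Solver)
  open +-*-Solver using (solve; var; _:+_; _:*_; _:-_; :-_; _:=_)
  open PolynomialExpressions using (#_; Poly₂; eval₂)
  open Coefficients using (α; β; γ; αₛ; βₛ; γₛ; k+2p-pos)
  open RationalEmbedding using (⟦_⟧ℚ; ℤ→ℚ-⟦⟧; ℤ→ℚ-≢0; clear-denominators)

  -- Transcriptions of the formulas of Defs in the variables (n, k), term for term, so that for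
  -- instance y n k and ⟦ yₛ ⟧ℚ₂ n k are definitionally equal.
  D₁ₛ D₂ₛ D₃ₛ N₁ₛ N₂ₛ N₃ₛ yₛ Xdenₛ XXₛ : Poly₂
  D₁ₛ n k = # 2 :* n :- # 3 :* k :+ # 3
  D₂ₛ n k = n :- # 2 :* k
  D₃ₛ n k = # 2 :* n :- # 3 :* k
  N₁ₛ n k = k :- # 1
  N₂ₛ n k = k :+ # 3
  N₃ₛ n k = k :+ # 2
  yₛ n k =
    (# 4 :* n :* n :+ (# 4 :- # 12 :* k) :* n :+ # 9 :* k :* k :- # 5 :* k)
    :* (# 4 :* n :* n :* n :* n :+ (# 28 :- # 36 :* k) :* n :* n :* n
        :+ (# 60 :- # 149 :* k :+ # 117 :* k :* k) :* n :* n
        :+ (# 36 :- # 174 :* k :+ # 276 :* k :* k :- # 162 :* k :* k :* k) :* n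
        :+ # 81 :* k :* k :* k :* k :- # 171 :* k :* k :* k :+ # 135 :* k :* k :- # 45 :* k)
  Xdenₛ n k = # 2 :* D₁ₛ n k :* D₃ₛ n k :* D₂ₛ n k
  XXₛ n k = # 3 :* D₁ₛ n k :* D₃ₛ n k :* D₂ₛ n k :+ N₁ₛ n k :* D₃ₛ n k :* D₂ₛ n k
            :+ N₂ₛ n k :* D₁ₛ n k :* D₃ₛ n k :- N₃ₛ n k :* D₁ₛ n k :* D₂ₛ n k

  ⟦_⟧ℚ₂ : Poly₂ → ℕ → ℕ → ℚ.ℚ
  ⟦ f ⟧ℚ₂ n k = ⟦ f (var zero) (var (suc zero)) ⟧ℚ (ℕ→ℚ n ∷ ℕ→ℚ k ∷ [])

  ⟦⟧ℚ₂-at : ∀ (f : Poly₂) k p → ⟦ f ⟧ℚ₂ (2 ℕ.* k ℕ.+ p) k ≡ ℤ→ℚ (eval₂ f (+ 2 ℤ.* + k ℤ.+ + p) (+ k))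
  ⟦⟧ℚ₂-at f k p = trans (sym (ℤ→ℚ-⟦⟧ (f {2} (var zero) (var (suc zero))) (+ (2 ℕ.* k ℕ.+ p) ∷ + k ∷ [])))
    (cong (λ n → ℤ→ℚ (eval₂ f n (+ k))) (trans (ℤ.pos-+ (2 ℕ.* k) p) (cong (ℤ._+ + p) (ℤ.pos-* 2 k))))

  private
    y-discriminant : ∀ k p → eval₂ yₛ (+ 2 ℤ.* k ℤ.+ p) k ≡ β k p ℤ.* β k p ℤ.- + 4 ℤ.* α k p ℤ.* γ k p
    y-discriminant = solve 2 (λ k p →
      yₛ (# 2 :* k :+ p) k := βₛ k p :* βₛ k p :- # 4 :* αₛ k p :* γₛ k p) refl

    Xden-α : ∀ k p → eval₂ Xdenₛ (+ 2 ℤ.* k ℤ.+ p) k ≡ + 2 ℤ.* α k p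
    Xden-α = solve 2 (λ k p → Xdenₛ (# 2 :* k :+ p) k := # 2 :* αₛ k p) refl

    XX-β : ∀ k p → eval₂ XXₛ (+ 2 ℤ.* k ℤ.+ p) k ≡ ℤ.- β k p
    XX-β = solve 2 (λ k p → XXₛ (# 2 :* k :+ p) k := :- βₛ k p) refl

    D₁-value : ∀ k p → eval₂ D₁ₛ (+ 2 ℤ.* k ℤ.+ p) k ≡ k ℤ.+ + 2 ℤ.* p ℤ.+ + 3
    D₁-value = solve 2 (λ k p → D₁ₛ (# 2 :* k :+ p) k := k :+ # 2 :* p :+ # 3) refl

    D₂-value : ∀ k p → eval₂ D₂ₛ (+ 2 ℤ.* k ℤ.+ p) k ≡ p
    D₂-value = solve 2 (λ k p → D₂ₛ (# 2 :* k :+ p) k := p) refl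

    D₃-value : ∀ k p → eval₂ D₃ₛ (+ 2 ℤ.* k ℤ.+ p) k ≡ k ℤ.+ + 2 ℤ.* p
    D₃-value = solve 2 (λ k p → D₃ₛ (# 2 :* k :+ p) k := k :+ # 2 :* p) refl

  module _ (k r : ℕ) where

    private
      n : ℕ
      n = 2 ℕ.* k ℕ.+ suc r
      K p : ℤ.ℤ
      K = + k
      p = + suc r

    y≡discriminant : y n k ≡ ℤ→ℚ (β K p ℤ.* β K p ℤ.- + 4 ℤ.* α K p ℤ.* γ K p)
    y≡discriminant = trans (⟦⟧ℚ₂-at yₛ k (suc r)) (cong ℤ→ℚ (y-discriminant K p))

    Xden≡2α : Xden n k ≡ ℤ→ℚ (+ 2 ℤ.* α K p)
    Xden≡2α = trans (⟦⟧ℚ₂-at Xdenₛ k (suc r)) (cong ℤ→ℚ (Xden-α K p))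

    Xrat*Xden≡-β : Xrat n k ℚ.* Xden n k ≡ ℤ→ℚ (ℤ.- β K p)
    Xrat*Xden≡-β = trans
      (clear-denominators _ _ _
        (denominator≢0 D₁ₛ (D₁-value K p) (ℤ.+-mono-<-≤ (k+2p-pos k r) (+≤+ z≤n)))
        (denominator≢0 D₂ₛ (D₂-value K p) (+<+ (s≤s z≤n)))
        (denominator≢0 D₃ₛ (D₃-value K p) (k+2p-pos k r)))
      (trans (⟦⟧ℚ₂-at XXₛ k (suc r)) (cong ℤ→ℚ (XX-β K p)))
      where
      denominator≢0 : ∀ (f : Poly₂) {i} → eval₂ f (+ 2 ℤ.* K ℤ.+ p) K ≡ i → ℤ.0ℤ ℤ.< i →
        ⟦ f ⟧ℚ₂ n k ≢ ℚ.0ℚ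
      denominator≢0 f value 0<i =
        subst (_≢ ℚ.0ℚ) (sym (trans (⟦⟧ℚ₂-at f k (suc r)) (cong ℤ→ℚ value))) (ℤ→ℚ-≢0 0<i)

module RatioBound where

  open import Data.Nat as ℕ using (suc)
  import Data.Nat.Properties as ℕ
  open import Data.Integer as ℤ using (+_)
  import Data.Integer.Properties as ℤ
  import Data.Rational as ℚ
  open import Relation.Binary.PropositionalEquality
  import Data.Rational.Solver as ℚ-Solver
  open ℚ-Solver.+-*-Solver using (solve; _:*_; _:-_; _:=_)
  open Recurrence using (dℤ)
  open QuadraticForms using (polar; discriminant-nonNeg)
  open Coefficients using (α; β; γ; α-pos)
  open RatioInvariant using (module Invariant; invariant; polar-Ψ-pos; Ψ[2,1]<0)
  open RationalEmbedding using (ℤ→ℚ-neg; sqrtLe-discriminant-polar)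
  open DefsAsPolynomials using (y≡discriminant; Xden≡2α; Xrat*Xden≡-β)

  ratio-bound : ∀ k r → let n = 2 ℕ.* k ℕ.+ suc r in
    SqrtLe (y n k) (((ℕ→ℚ (d n k) ÷' ℕ→ℚ (d (n ℕ.∸ 1) k)) ℚ.- Xrat n k) ℚ.* Xden n k)
  ratio-bound k r = subst₂ SqrtLe (sym (y≡discriminant k r)) (sym shape)
    (sqrtLe-discriminant-polar (α K p) (β K p) (γ K p) d-pos 0≤α 0≤disc 0≤V Ψ-nonNeg)
    where
    open Invariant (invariant k r)
    open ≡-Reasoning
    n : ℕ.ℕ
    n = 2 ℕ.* k ℕ.+ suc r
    K p : ℤ.ℤ
    K = + k
    p = + suc r
    0≤α : ℤ.0ℤ ℤ.≤ α K p
    0≤α = ℤ.<⇒≤ (α-pos k r)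
    0≤V : ℤ.0ℤ ℤ.≤ polar (α K p) (β K p) (dℤ k (suc r)) (dℤ k r)
    0≤V = ℤ.<⇒≤ (polar-Ψ-pos k r Ψ-nonNeg doubling d-pos)
    0≤disc : ℤ.0ℤ ℤ.≤ β K p ℤ.* β K p ℤ.- + 4 ℤ.* α K p ℤ.* γ K p
    0≤disc = discriminant-nonNeg (α K p) (β K p) (γ K p) (+ 2) 0≤α (ℤ.<⇒≤ (Ψ[2,1]<0 k r))
    ρ : ℚ.ℚ
    ρ = ℤ→ℚ (dℤ k (suc r)) ÷' ℤ→ℚ (dℤ k r)
    shape : ((ℕ→ℚ (d n k) ÷' ℕ→ℚ (d (n ℕ.∸ 1) k)) ℚ.- Xrat n k) ℚ.* Xden n k
            ≡ ρ ℚ.* ℤ→ℚ (+ 2 ℤ.* α K p) ℚ.+ ℤ→ℚ (β K p)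
    shape = begin
      ((ℕ→ℚ (d n k) ÷' ℕ→ℚ (d (n ℕ.∸ 1) k)) ℚ.- Xrat n k) ℚ.* Xden n k
        ≡⟨ cong (λ m → ((ℕ→ℚ (d n k) ÷' ℕ→ℚ (d m k)) ℚ.- Xrat n k) ℚ.* Xden n k)
                (cong (ℕ._∸ 1) (ℕ.+-suc (2 ℕ.* k) r)) ⟩
      (ρ ℚ.- Xrat n k) ℚ.* Xden n k
        ≡⟨ solve 3 (λ ρ R D → (ρ :- R) :* D := ρ :* D :- R :* D) refl ρ (Xrat n k) (Xden n k) ⟩
      ρ ℚ.* Xden n k ℚ.- Xrat n k ℚ.* Xden n k
        ≡⟨ cong₂ (λ a b → ρ ℚ.* a ℚ.- b) (Xden≡2α k r) (Xrat*Xden≡-β k r) ⟩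
      ρ ℚ.* ℤ→ℚ (+ 2 ℤ.* α K p) ℚ.- ℤ→ℚ (ℤ.- β K p)
        ≡⟨ cong (λ t → ρ ℚ.* ℤ→ℚ (+ 2 ℤ.* α K p) ℚ.+ t)
                (trans (sym (ℤ→ℚ-neg (ℤ.- β K p))) (cong ℤ→ℚ (ℤ.neg-involutive (β K p)))) ⟩
      ρ ℚ.* ℤ→ℚ (+ 2 ℤ.* α K p) ℚ.+ ℤ→ℚ (β K p) ∎

open import Data.Nat using (ℕ; _≤_; _+_; _*_; _∸_)
open import Data.Nat.Properties using (+-assoc; m+[n∸m]≡n)
open import Data.Rational as ℚ using ()
open import Relation.Binary.PropositionalEquality using (subst; sym; trans)
open RatioBound using (ratio-bound)

-- The bound holds for k = 0 as well.
lemma5p3 : (n k : ℕ) → 1 ≤ k → 2 * k + 1 ≤ n →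
    SqrtLe (y n k) (((ℕ→ℚ (d n k) ÷' ℕ→ℚ (d (n ∸ 1) k)) ℚ.- Xrat n k) ℚ.* Xden n k)
lemma5p3 n k _ 2k+1≤n =
  subst (λ n → SqrtLe (y n k) (((ℕ→ℚ (d n k) ÷' ℕ→ℚ (d (n ∸ 1) k)) ℚ.- Xrat n k) ℚ.* Xden n k))
        (trans (sym (+-assoc (2 * k) 1 r)) (m+[n∸m]≡n 2k+1≤n))
        (ratio-bound k r)
  where
  r : ℕ
  r = n ∸ (2 * k + 1)
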